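{- Let $L\supseteq\mathsf{CKCEM}$ be a logic in the language $\mathcal{L}_{\triangleright}$, and let $p,q,r$ be distinct atoms. If $L$ has the uniform Lyndon interpolation property, then $L\vdash(p\triangleright r)\vee(q\triangleright\neg r)$.
   Context: $\mathcal{L}_{\triangleright}$: formulas from atoms and $\bot$ with $\wedge,\vee,\to$ and binary $\triangleright$; $\top:=\bot\to\bot$, $\neg A:=A\to\bot$. A logic is a set of formulas containing all classical tautologies, closed under substitution and modus ponens. $\mathsf{CE}$: smallest set of formulas containing classical tautologies, closed under modus ponens and the rule from $\phi_0\leftrightarrow\phi_1$ and $\psi_0\leftrightarrow\psi_1$ infer $(\phi_0\triangleright\psi_0)\to(\phi_1\triangleright\psi_1)$. Axioms: (CM) $(\phi\triangleright\psi\wedge\theta)\to(\phi\triangleright\psi)\wedge(\phi\triangleright\theta)$; (CC) $(\phi\triangleright\psi)\wedge(\phi\triangleright\theta)\to(\phi\triangleright\psi\wedge\theta)$; (CN) $\phi\triangleright\top$; (CEM) $(\phi\triangleright\psi)\vee(\phi\triangleright\neg\psi)$. $\mathsf{CKCEM}=\mathsf{CE}+(CM)+(CC)+(CN)+(CEM)$ (adding all instances and closing under the rules). Polarity: $V^+(p)=\{p\}$, $V^-(p)=\varnothing$, $V^{\pm}(\bot)=\varnothing$, $V^{\pm}$ distributes over $\wedge,\vee$, $V^+(\phi\to\psi)=V^-(\phi)\cup V^+(\psi)$, $V^-(\phi\to\psi)=V^+(\phi)\cup V^-(\psi)$, $V^+(\phi\triangleright\psi)=V^-(\phi)\cup V^+(\psi)$,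 $V^-(\phi\triangleright\psi)=V^+(\phi)\cup V^-(\psi)$; $\phi$ is $p^{\circ}$-free if $p\notin V^{\circ}(\phi)$. ULIP: for every formula $\phi$, atom $p$ and $\circ\in\{+,-\}$ there are $p^{\circ}$-free formulas $\forall^{\circ}p\,\phi,\exists^{\circ}p\,\phi$ with $V^{\dagger}(\forall^{\circ}p\,\phi),V^{\dagger}(\exists^{\circ}p\,\phi)\subseteq V^{\dagger}(\phi)$ for both $\dagger\in\{+,-\}$, such that $L\vdash\forall^{\circ}p\,\phi\to\phi$; for every $p^{\circ}$-free $\psi$, $L\vdash\psi\to\phi$ implies $L\vdash\psi\to\forall^{\circ}p\,\phi$; $L\vdash\phi\to\exists^{\circ}p\,\phi$; and for every $p^{\circ}$-free $\psi$, $L\vdash\phi\to\psi$ implies $L\vdash\exists^{\circ}p\,\phi\to\psi$. -}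

module Defs where

open import Data.Nat using (ℕ; _≡ᵇ_)
open import Data.Bool using (Bool; true; false; _∨_; _∧_)
open import Data.Product using (Σ; _×_)
open import Relation.Binary.PropositionalEquality using (_≡_)

infixr 5 _⇒_
infixl 6 _∨'_
infixl 7 _∧'_
infix 8 _▷_

data Fm : Set where
  var  : ℕ → Fm
  ⊥'   : Fm
  _∧'_ : Fm → Fm → Fm
  _∨'_ : Fm → Fm → Fm
  _⇒_  : Fm → Fm → Fm
  _▷_  : Fm → Fm → Fm

⊤' : Fm
⊤' = ⊥' ⇒ ⊥'

¬' : Fm → Fm
¬' A = A ⇒ ⊥'

_⇔_ : Fm → Fm → Fm
A ⇔ B = (A ⇒ B) ∧' (B ⇒ A)

-- Classical evaluation: atoms and ▷-formulas are the propositional "letters"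
eval : (Fm → Bool) → Fm → Bool
eval v (var p)  = v (var p)
eval v ⊥'       = false
eval v (A ∧' B) = eval v A ∧ eval v B
eval v (A ∨' B) = eval v A ∨ eval v B
eval v (A ⇒ B)  = impB (eval v A) (eval v B)
  where
  impB : Bool → Bool → Bool
  impB true  b = b
  impB false _ = true
eval v (A ▷ B)  = v (A ▷ B)

-- classical tautology (substitution instance of a propositional tautology)
Taut : Fm → Set
Taut A = ∀ (v : Fm → Bool) → eval v A ≡ true

subst : (ℕ → Fm) → Fm → Fm
subst σ (var p)  = σ p
subst σ ⊥'       = ⊥'
subst σ (A ∧' B) = subst σ A ∧' subst σ B
subst σ (A ∨' B) = subst σ A ∨' subst σ B
subst σ (A ⇒ B)  = subst σ A ⇒ subst σ B
subst σ (A ▷ B)  = subst σ A ▷ subst σ B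

record IsLogic (L : Fm → Set) : Set where
  field
    taut  : ∀ A → Taut A → L A
    sub   : ∀ σ A → L A → L (subst σ A)
    mp    : ∀ A B → L (A ⇒ B) → L A → L B

data CKCEM : Fm → Set where
  taut : ∀ {A} → Taut A → CKCEM A
  mp   : ∀ {A B} → CKCEM (A ⇒ B) → CKCEM A → CKCEM B
  re   : ∀ {φ₀ φ₁ ψ₀ ψ₁} → CKCEM (φ₀ ⇔ φ₁) → CKCEM (ψ₀ ⇔ ψ₁) →
         CKCEM ((φ₀ ▷ ψ₀) ⇒ (φ₁ ▷ ψ₁))
  cm   : ∀ φ ψ θ → CKCEM ((φ ▷ (ψ ∧' θ)) ⇒ ((φ ▷ ψ) ∧' (φ ▷ θ)))
  cc   : ∀ φ ψ θ → CKCEM (((φ ▷ ψ) ∧' (φ ▷ θ)) ⇒ (φ ▷ (ψ ∧' θ)))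
  cn   : ∀ φ → CKCEM (φ ▷ ⊤')
  cem  : ∀ φ ψ → CKCEM ((φ ▷ ψ) ∨' (φ ▷ ¬' ψ))

data Pol : Set where
  pos neg : Pol

flipP : Pol → Pol
flipP pos = neg
flipP neg = pos

occ : Pol → ℕ → Fm → Bool
occ pos p (var q) = p ≡ᵇ q
occ neg p (var q) = false
occ s p ⊥'        = false
occ s p (A ∧' B)  = occ s p A ∨ occ s p B
occ s p (A ∨' B)  = occ s p A ∨ occ s p B
occ s p (A ⇒ B)   = occ (flipP s) p A ∨ occ s p B
occ s p (A ▷ B)   = occ (flipP s) p A ∨ occ s p B

Free : Pol → ℕ → Fm → Set
Free s p A = occ s p A ≡ false

VarsSub : Fm → Fm → Set
VarsSub A B = ∀ t q → occ t q A ≡ true → occ t q B ≡ true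

ULIP : (Fm → Set) → Set
ULIP L = ∀ (φ : Fm) (p : ℕ) (s : Pol) →
  Σ Fm (λ A →
      Free s p A × VarsSub A φ × L (A ⇒ φ) ×
      (∀ ψ → Free s p ψ → L (ψ ⇒ φ) → L (ψ ⇒ A)))
  ×
  Σ Fm (λ E →
      Free s p E × VarsSub E φ × L (φ ⇒ E) ×
      (∀ ψ → Free s p ψ → L (φ ⇒ ψ) → L (E ⇒ ψ)))

-- ¬(q ▷ r) ⊢ q ▷ ¬r by (CEM), and q occurs only negatively on the right,
-- so the conclusion factors through the uniform interpolant E = ∃⁺q ¬(q ▷ r).
-- E has no positive q by construction and no negative q because ¬(q ▷ r) has
-- none, so E does not mention q at all.  Substituting p for q in ¬(q ▷ r) → E
-- therefore yields ¬(p ▷ r) → E, and with E → q ▷ ¬r we get the disjunction.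
module Submission where

open import Defs
open import Data.Nat using (ℕ; _≡ᵇ_)
open import Data.Nat.Properties using (≡ᵇ⇒≡; ≡⇒≡ᵇ)
open import Data.Bool using (true; false; if_then_else_)
open import Data.Bool.Properties using (∨-conicalˡ; ∨-conicalʳ; ¬-not; not-¬; T-≡)
open import Data.Product using (_,_)
open import Function.Bundles using (Equivalence)
open import Relation.Binary.PropositionalEquality
  using (_≡_; _≢_; refl; cong₂) renaming (subst to transport)

≡ᵇ-refl : ∀ n → (n ≡ᵇ n) ≡ true
≡ᵇ-refl n = Equivalence.to T-≡ (≡⇒≡ᵇ n n refl)

≢⇒≡ᵇ-false : ∀ {m n} → m ≢ n → (m ≡ᵇ n) ≡ false
≢⇒≡ᵇ-false {m} {n} m≢n = ¬-not (λ m≡ᵇn → m≢n (≡ᵇ⇒≡ m n (Equivalence.from T-≡ m≡ᵇn)))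

VarsSub-free : ∀ {A B} s p → VarsSub A B → Free s p B → Free s p A
VarsSub-free s p A⊆B B-free = ¬-not (λ occA → not-¬ (A⊆B s p occA) B-free)

replace : ℕ → Fm → ℕ → Fm
replace q A n = if q ≡ᵇ n then A else var n

subst-replace-fresh : ∀ q A E → Free pos q E → Free neg q E → subst (replace q A) E ≡ E
subst-replace-fresh q A (var n) q⁺-free _ rewrite q⁺-free = refl
subst-replace-fresh q A ⊥' _ _ = refl
subst-replace-fresh q A (B ∧' C) q⁺ q⁻ =
  cong₂ _∧'_ (subst-replace-fresh q A B (∨-conicalˡ _ _ q⁺) (∨-conicalˡ _ _ q⁻))
             (subst-replace-fresh q A C (∨-conicalʳ _ _ q⁺) (∨-conicalʳ _ _ q⁻))
subst-replace-fresh q A (B ∨' C) q⁺ q⁻ =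
  cong₂ _∨'_ (subst-replace-fresh q A B (∨-conicalˡ _ _ q⁺) (∨-conicalˡ _ _ q⁻))
             (subst-replace-fresh q A C (∨-conicalʳ _ _ q⁺) (∨-conicalʳ _ _ q⁻))
subst-replace-fresh q A (B ⇒ C) q⁺ q⁻ =
  cong₂ _⇒_ (subst-replace-fresh q A B (∨-conicalˡ _ _ q⁻) (∨-conicalˡ _ _ q⁺))
            (subst-replace-fresh q A C (∨-conicalʳ _ _ q⁺) (∨-conicalʳ _ _ q⁻))
subst-replace-fresh q A (B ▷ C) q⁺ q⁻ =
  cong₂ _▷_ (subst-replace-fresh q A B (∨-conicalˡ _ _ q⁻) (∨-conicalˡ _ _ q⁺))
            (subst-replace-fresh q A C (∨-conicalʳ _ _ q⁺) (∨-conicalʳ _ _ q⁻))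

∨⇒¬⇒-taut : ∀ X Y → Taut ((X ∨' Y) ⇒ (¬' X ⇒ Y))
∨⇒¬⇒-taut X Y v with eval v X | eval v Y
... | true  | _     = refl
... | false | true  = refl
... | false | false = refl

¬⇒⇒∨-taut : ∀ X Y → Taut ((¬' X ⇒ Y) ⇒ (X ∨' Y))
¬⇒⇒∨-taut X Y v with eval v X | eval v Y
... | true  | _     = refl
... | false | true  = refl
... | false | false = refl

⇒-trans-taut : ∀ A B C → Taut ((A ⇒ B) ⇒ ((B ⇒ C) ⇒ (A ⇒ C)))
⇒-trans-taut A B C v with eval v A | eval v B | eval v C
... | true  | true  | true  = refl
... | true  | true  | false = refl
... | true  | false | true  = refl
... | true  | false | false = refl
... | false | true  | true  = refl
... | false | true  | false = refl
... | false | false | true  = refl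
... | false | false | false = refl

module _ {L : Fm → Set} (logic : IsLogic L) where
  open IsLogic logic renaming (taut to ⊢taut; mp to ⊢mp; sub to ⊢sub)

  mp-taut : ∀ {A B} → Taut (A ⇒ B) → L A → L B
  mp-taut {A} {B} ⊨A⇒B ⊢A = ⊢mp A B (⊢taut (A ⇒ B) ⊨A⇒B) ⊢A

  ⇒-trans : ∀ {A B C} → L (A ⇒ B) → L (B ⇒ C) → L (A ⇒ C)
  ⇒-trans {A} {B} {C} ⊢A⇒B = ⊢mp (B ⇒ C) (A ⇒ C) (mp-taut (⇒-trans-taut A B C) ⊢A⇒B)

  ulip⇒subst-premise : ULIP L → ∀ q A φ ψ → Free neg q φ → Free pos q ψ →
    L (φ ⇒ ψ) → L (subst (replace q A) φ ⇒ ψ)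
  ulip⇒subst-premise ulip q A φ ψ φ-q⁻free ψ-q⁺free ⊢φ⇒ψ
    with ulip φ q pos
  ... | _ , (E , E-q⁺free , E⊆φ , ⊢φ⇒E , E-least) =
    ⇒-trans ⊢σφ⇒E (E-least ψ ψ-q⁺free ⊢φ⇒ψ)
    where
    σ : ℕ → Fm
    σ = replace q A

    σE≡E : subst σ E ≡ E
    σE≡E = subst-replace-fresh q A E E-q⁺free (VarsSub-free neg q E⊆φ φ-q⁻free)

    ⊢σφ⇒E : L (subst σ φ ⇒ E)
    ⊢σφ⇒E = transport (λ F → L (subst σ φ ⇒ F)) σE≡E (⊢sub σ (φ ⇒ E) ⊢φ⇒E)

mainTheorem9 : (L : Fm → Set) → IsLogic L → (∀ A → CKCEM A → L A) →
    (p q r : ℕ) → p ≢ q → p ≢ r → q ≢ r →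
    ULIP L → L ((var p ▷ var r) ∨' (var q ▷ ¬' (var r)))
mainTheorem9 L logic ckcem p q r _ _ q≢r ulip =
  mp-taut logic (¬⇒⇒∨-taut (var p ▷ var r) ψ)
    (transport (λ F → L (F ⇒ ψ)) renamed
      (ulip⇒subst-premise logic ulip q (var p) φ ψ φ-q⁻free refl ⊢φ⇒ψ))
  where
  φ ψ : Fm
  φ = ¬' (var q ▷ var r)
  ψ = var q ▷ ¬' (var r)

  ⊢φ⇒ψ : L (φ ⇒ ψ)
  ⊢φ⇒ψ = mp-taut logic (∨⇒¬⇒-taut (var q ▷ var r) ψ) (ckcem _ (cem (var q) (var r)))

  φ-q⁻free : Free neg q φ
  φ-q⁻free rewrite ≢⇒≡ᵇ-false q≢r = refl

  renamed : subst (replace q (var p)) φ ≡ ¬' (var p ▷ var r)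
  renamed rewrite ≡ᵇ-refl q | ≢⇒≡ᵇ-false q≢r = refl
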